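{- Define the "natural representation" $s(x)$ of a rational number $x$, a finite sequence of integers $(s_0,s_1,\dots,s_k)$, recursively as follows. If $x$ is an integer, $s(x)=(x)$. Otherwise, put $\varphi=x-\lfloor x\rfloor\in(0,1)$; if $\varphi<\tfrac12$, let $s(x)$ be $\lceil x\rceil$ followed by the negatives of the entries of $s\!\left(\tfrac{1}{\varphi}-2\right)$; if $\varphi\ge\tfrac12$, let $s(x)$ be $\lceil x\rceil$ followed by the entries of $s\!\left(\tfrac{1}{1-\varphi}-2\right)$. Define a relation $\succ$ on distinct finite integer sequences $A=(a_0,\dots,a_p)$, $B=(b_0,\dots,b_q)$ by: (i) if there is an index $i\le\min(p,q)$ with $a_i\ne b_i$, take the least such $i$; then $A\succ B$ iff $a_i>b_i$; (ii) otherwise one is a proper prefix of the other; if $A$ is a proper prefix of $B$ (so $p<q$), then $A\succ B$ when $p=0$ or $a_p>0$, and $B\succ A$ when $p>0$ and $a_p<0$ (and symmetrically if $B$ is a proper prefix of $A$). Write $A\preceq B$ if $A=B$ or $B\succ A$. Then for all rational numbers $x,y$: $x\le y$ if and only if $s(x)\preceq s(y)$.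
   Context: $\lfloor x\rfloor$ denotes the largest integer not exceeding $x$ and $\lceil x\rceil$ the smallest integer not less than $x$. For sequences of the form $s(x)$, an entry $a_p=0$ with $p>0$ can only occur as the last entry, so the prefix rule covers all cases that arise. -}

module Defs where

open import Data.Nat using (ℕ; zero; suc)
open import Data.Integer as ℤ using (ℤ)
open import Data.Rational using (ℚ; 0ℚ; 1ℚ; ½; floor; ceiling; _-_; _<_; 1/_; _/_; ↧ₙ_; ≢-nonZero)
open import Data.Rational.Properties using (_≟_; _<?_)
open import Data.List using (List; []; _∷_; [_]; _++_; _∷ʳ_; map)
open import Data.Product using (Σ; ∃; _×_; _,_)
open import Data.Sum using (_⊎_)
open import Relation.Nullary using (yes; no; ¬_)
open import Relation.Binary.PropositionalEquality using (_≡_)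

-- total inverse: 1/q for q ≠ 0 (only ever applied to nonzero arguments below)
inv : ℚ → ℚ
inv q with q ≟ 0ℚ
... | yes _ = 0ℚ
... | no q≢0 = 1/_ q {{≢-nonZero q≢0}}

2ℚ : ℚ
2ℚ = ℤ.+ 2 / 1

⌊_⌋ℚ : ℚ → ℚ
⌊ x ⌋ℚ = floor x / 1

frac : ℚ → ℚ
frac x = x - ⌊ x ⌋ℚ

-- natural representation with explicit fuel (recursion decreases the denominator)
sFuel : ℕ → ℚ → List ℤ
sFuel zero    x = [ floor x ]   -- never reached when fuel > denominator
sFuel (suc n) x with frac x ≟ 0ℚ
... | yes _ = [ floor x ]
... | no _ with frac x <? ½
...   | yes _ = ceiling x ∷ map ℤ.-_ (sFuel n (inv (frac x) - 2ℚ))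
...   | no _  = ceiling x ∷ sFuel n (inv (1ℚ - frac x) - 2ℚ)

-- s(x): fuel 1 + denominator is always enough
s : ℚ → List ℤ
s x = sFuel (suc (↧ₙ x)) x

data _≻_ : List ℤ → List ℤ → Set where
  differ : ∀ (C : List ℤ) (a b : ℤ) (A′ B′ : List ℤ) → a ℤ.> b →
           (C ++ a ∷ A′) ≻ (C ++ b ∷ B′)
  -- (ii) A = (a_0..a_p) proper prefix of B, and (p = 0 or a_p > 0)
  prefixL : ∀ (C : List ℤ) (a : ℤ) (d : ℤ) (D : List ℤ) → (C ≡ [] ⊎ a ℤ.> ℤ.0ℤ) →
            (C ∷ʳ a) ≻ ((C ∷ʳ a) ++ d ∷ D)
  -- (ii') B = (b_0..b_q) proper prefix of A, with q > 0 and b_q < 0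
  prefixR : ∀ (C : List ℤ) (b : ℤ) (d : ℤ) (D : List ℤ) → ¬ (C ≡ []) → b ℤ.< ℤ.0ℤ →
            ((C ∷ʳ b) ++ d ∷ D) ≻ (C ∷ʳ b)

_⪯_ : List ℤ → List ℤ → Set
A ⪯ B = A ≡ B ⊎ B ≻ A

module Submission where

-- The natural representation s : ℚ → List ℤ is strictly order preserving:
-- x < y implies s y ≻ s x.  Together with the asymmetry of ≻ this is the
-- theorem: x ≤ y if and only if s x ⪯ s y.
--
-- Its continuations lowRest x = 1/φ - 2 and
--    highRest x = 1/(1-φ) - 2 have smaller denominators than x, so s obeys its
--    defining equations; lowRest decreases and highRest increases with φ.
-- 4. Strong induction on ↧x + ↧y.  If ⌈x⌉ < ⌈y⌉ the first entries decide;
--    otherwise the tails are compared by the induction hypothesis, with the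
--    negation in the case φ < ½ compensating for the decrease of lowRest.

open import Defs
open import Data.Rational using (ℚ; _≤_)
open import Data.Product using (_×_)

open import Data.Nat as ℕ using (ℕ; zero; suc)
import Data.Nat.Properties as ℕP
open import Data.Nat.Divisibility using (_∣_; ∣⇒≤; m∣m*n)
open import Data.Nat.GCD using (gcd)
open import Data.Nat.Induction using (<-rec)
import Data.Nat.Coprimality as Coprime
open import Data.Integer as ℤ using (ℤ; +_; -[1+_]; +[1+_]; 0ℤ; 1ℤ)
import Data.Integer.Properties as ℤP
import Data.Integer.DivMod as ℤD
open import Data.Integer.Solver using (module +-*-Solver)
open import Data.Rational using (mkℚ; 0ℚ; 1ℚ; ½; floor; ceiling; _+_; _-_; -_; _<_; _/_; ↥_; ↧_; ↧ₙ_; *<*; *≤*)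
import Data.Rational.Properties as ℚP
open import Data.Rational.Solver using () renaming (module +-*-Solver to ℚS)
open import Data.List using (List; []; _∷_; [_]; _++_; _∷ʳ_; map)
open import Data.List.Properties using (++-identityʳ; ++-assoc)
open import Data.Maybe using (Maybe; nothing; just)
open import Data.Product using (Σ; _,_)
open import Data.Sum using (_⊎_; inj₁; inj₂)
open import Data.Unit using (⊤; tt)
open import Data.Empty using (⊥; ⊥-elim)
open import Relation.Nullary using (yes; no; ¬_)
open import Relation.Binary.Definitions using (tri<; tri≈; tri>)
open import Relation.Binary.PropositionalEquality hiding ([_])

-- The shape of a prefix shared by two sequences: empty, of length one, or
-- longer and ending in ℓ.  This is all the prefix rule of ≻ depends on.
data Prefix : Set where
  none  : Prefix
  after : Maybe ℤ → Prefix

-- Appending an entry a: the last entry is recorded once it is not the only one.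
-- Defined so that `extend π a` is visibly nonempty whatever π is.
extend : Prefix → ℤ → Prefix
extend π a = after (last π)
  where
  last : Prefix → Maybe ℤ
  last none      = nothing
  last (after _) = just a

-- `Above π A B`: after a shared prefix of shape π, the sequence continuing
-- with A is ≻-greater than the one continuing with B.  A recursive,
-- entry-by-entry reformulation of the relation ≻.
Above : Prefix → List ℤ → List ℤ → Set
Above π (a ∷ A) (b ∷ B) = a ℤ.> b ⊎ (a ≡ b × Above (extend π a) A B)
Above (after nothing)  []      (_ ∷ _) = ⊤
Above (after (just ℓ)) []      (_ ∷ _) = ℓ ℤ.> 0ℤ
Above (after (just ℓ)) (_ ∷ _) []      = ℓ ℤ.< 0ℤ
Above _                _       _       = ⊥

-- Asymmetry of `Above`: at the first difference, or at the end of the shorter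
-- sequence, the two comparisons demand opposite signs.
Above-asym : ∀ π A B → Above π A B → ¬ Above π B A
Above-asym π (a ∷ A) (b ∷ B) (inj₁ a>b)       (inj₁ b>a)       = ℤP.<-asym a>b b>a
Above-asym π (a ∷ A) (b ∷ B) (inj₁ a>b)       (inj₂ (refl , _)) = ℤP.<-irrefl refl a>b
Above-asym π (a ∷ A) (b ∷ B) (inj₂ (refl , _)) (inj₁ b>a)       = ℤP.<-irrefl refl b>a
Above-asym π (a ∷ A) (b ∷ B) (inj₂ (refl , g)) (inj₂ (_ , h))   = Above-asym (extend π a) A B g h
Above-asym (after (just ℓ)) []      (_ ∷ _) ℓ>0 ℓ<0 = ℤP.<-asym ℓ>0 ℓ<0
Above-asym (after (just ℓ)) (_ ∷ _) []      ℓ<0 ℓ>0 = ℤP.<-asym ℓ<0 ℓ>0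
Above-asym (after nothing)  []      []      ()
Above-asym (after (just ℓ)) []      []      ()

negate : List ℤ → List ℤ
negate = map (ℤ.-_)

-- Negating every entry reverses the order, provided the shared prefix is
-- nonempty (so that the prefix rule is governed by the sign of its last entry).
Above-negate : ∀ ℓ A B → Above (after (just ℓ)) A B →
               Above (after (just (ℤ.- ℓ))) (negate B) (negate A)
Above-negate ℓ (a ∷ A) (b ∷ B) (inj₁ a>b)       = inj₁ (ℤP.neg-mono-< a>b)
Above-negate ℓ (a ∷ A) (b ∷ B) (inj₂ (refl , g)) = inj₂ (refl , Above-negate a A B g)
Above-negate ℓ []      (_ ∷ _) ℓ>0 = ℤP.neg-mono-< ℓ>0
Above-negate ℓ (_ ∷ _) []      ℓ<0 = ℤP.neg-mono-< ℓ<0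

-- For nonempty sequences, the comparison after a nonempty prefix does not depend
-- on the prefix; so negation reverses it after any nonempty prefix.
Above-negate-cons : ∀ m m′ {a b A B} → Above (after m) (a ∷ A) (b ∷ B) →
                    Above (after m′) (negate (b ∷ B)) (negate (a ∷ A))
Above-negate-cons m m′ (inj₁ a>b)                        = inj₁ (ℤP.neg-mono-< a>b)
Above-negate-cons m m′ {a} {A = A} {B} (inj₂ (refl , g)) = inj₂ (refl , Above-negate a A B g)

above-differ : ∀ π C {a b A B} → a ℤ.> b → Above π (C ++ a ∷ A) (C ++ b ∷ B)
above-differ π []      a>b = inj₁ a>b
above-differ π (c ∷ C) a>b = inj₂ (refl , above-differ (extend π c) C a>b)

above-prefix : ∀ π C {a d D} → a ℤ.> 0ℤ → Above π (C ∷ʳ a) ((C ∷ʳ a) ++ d ∷ D)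
above-prefix none      []      a>0 = inj₂ (refl , tt)
above-prefix (after _) []      a>0 = inj₂ (refl , a>0)
above-prefix π         (c ∷ C) a>0 = inj₂ (refl , above-prefix (extend π c) C a>0)

below-prefix : ∀ m C {b d D} → b ℤ.< 0ℤ → Above (after m) ((C ∷ʳ b) ++ d ∷ D) (C ∷ʳ b)
below-prefix m []      b<0 = inj₂ (refl , b<0)
below-prefix m (c ∷ C) b<0 = inj₂ (refl , below-prefix (just c) C b<0)

≻⇒Above : ∀ {A B} → A ≻ B → Above none A B
≻⇒Above (differ C a b A′ B′ a>b)         = above-differ none C a>b
≻⇒Above (prefixL _ a d D (inj₁ refl))    = inj₂ (refl , tt)
≻⇒Above (prefixL C a d D (inj₂ a>0))     = above-prefix none C a>0
≻⇒Above (prefixR []      b d D C≢[] b<0) = ⊥-elim (C≢[] refl)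
≻⇒Above (prefixR (c ∷ C) b d D _    b<0) = inj₂ (refl , below-prefix nothing C b<0)

data Describes : Prefix → List ℤ → Set where
  empty  : Describes none []
  single : ∀ c → Describes (after nothing) [ c ]
  longer : ∀ c Q ℓ → Describes (after (just ℓ)) ((c ∷ Q) ∷ʳ ℓ)

describes-extend : ∀ {π P} a → Describes π P → Describes (extend π a) (P ∷ʳ a)
describes-extend a empty          = single a
describes-extend a (single c)     = longer c [] a
describes-extend a (longer c Q ℓ) = longer c (Q ∷ʳ ℓ) a

Above⇒≻ : ∀ {π P} A B → Describes π P → Above π A B → (P ++ A) ≻ (P ++ B)
Above⇒≻ {P = P} (a ∷ A) (b ∷ B) _ (inj₁ a>b) = differ P a b A B a>b
Above⇒≻ {P = P} (a ∷ A) (b ∷ B) δ (inj₂ (refl , g)) =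
  subst₂ _≻_ (++-assoc P [ a ] A) (++-assoc P [ a ] B)
    (Above⇒≻ A B (describes-extend a δ) g)
Above⇒≻ [] (d ∷ D) (single c) tt = prefixL [] c d D (inj₁ refl)
Above⇒≻ [] (d ∷ D) (longer c Q ℓ) ℓ>0 =
  subst (_≻ (((c ∷ Q) ∷ʳ ℓ) ++ d ∷ D)) (sym (++-identityʳ ((c ∷ Q) ∷ʳ ℓ)))
    (prefixL (c ∷ Q) ℓ d D (inj₂ ℓ>0))
Above⇒≻ (d ∷ D) [] (longer c Q ℓ) ℓ<0 =
  subst ((((c ∷ Q) ∷ʳ ℓ) ++ d ∷ D) ≻_) (sym (++-identityʳ ((c ∷ Q) ∷ʳ ℓ)))
    (prefixR (c ∷ Q) ℓ d D (λ ()) ℓ<0)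
Above⇒≻ [] [] (single c) ()
Above⇒≻ [] [] (longer c Q ℓ) ()
Above⇒≻ (d ∷ D) [] (single c) ()

⪯⇒⊁ : ∀ {A B} → A ⪯ B → ¬ A ≻ B
⪯⇒⊁ {A} (inj₁ refl) A≻A = Above-asym none A A (≻⇒Above A≻A) (≻⇒Above A≻A)
⪯⇒⊁ {A} {B} (inj₂ B≻A) A≻B = Above-asym none B A (≻⇒Above B≻A) (≻⇒Above A≻B)

ι : ℤ → ℚ
ι k = k / 1

ι≡mkℚ : ∀ k → ι k ≡ mkℚ k 0 (Coprime.sym (Coprime.1-coprimeTo ℤ.∣ k ∣))
ι≡mkℚ (+ n)    = ℚP.normalize-coprime (Coprime.sym (Coprime.1-coprimeTo n))
ι≡mkℚ -[1+ n ] = cong -_ (ℚP.normalize-coprime (Coprime.sym (Coprime.1-coprimeTo (suc n))))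

↧ι : ∀ k → ↧ (ι k) ≡ 1ℤ
↧ι k rewrite ι≡mkℚ k = refl

ι-mono-< : ∀ {k m} → k ℤ.< m → ι k < ι m
ι-mono-< {k} {m} k<m rewrite ι≡mkℚ k | ι≡mkℚ m =
  *<* (subst₂ ℤ._<_ (sym (ℤP.*-identityʳ k)) (sym (ℤP.*-identityʳ m)) k<m)

ι-cancel-< : ∀ {k m} → ι k < ι m → k ℤ.< m
ι-cancel-< {k} {m} ιk<ιm rewrite ι≡mkℚ k | ι≡mkℚ m with ιk<ιm
... | *<* k<m = subst₂ ℤ._<_ (ℤP.*-identityʳ k) (ℤP.*-identityʳ m) k<m

ι-cancel-≤ : ∀ {k m} → ι k ≤ ι m → k ℤ.≤ m
ι-cancel-≤ {k} {m} ιk≤ιm rewrite ι≡mkℚ k | ι≡mkℚ m with ιk≤ιm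
... | *≤* k≤m = subst₂ ℤ._≤_ (ℤP.*-identityʳ k) (ℤP.*-identityʳ m) k≤m

ι-+ : ∀ k m → ι (k ℤ.+ m) ≡ ι k + ι m
ι-+ k m rewrite ι≡mkℚ k | ι≡mkℚ m =
  cong (_/ 1) (sym (cong₂ ℤ._+_ (ℤP.*-identityʳ k) (ℤP.*-identityʳ m)))

ι-neg : ∀ k → ι (ℤ.- k) ≡ - ι k
ι-neg (+ zero)  = refl
ι-neg (+ suc n) = refl
ι-neg -[1+ n ]  rewrite ι≡mkℚ (+ suc n) = refl

floor-≤ : ∀ x → ι (floor x) ≤ x
floor-≤ x@(mkℚ n d-1 _) rewrite ι≡mkℚ (floor x) = *≤* (begin
  (n ℤ./ d) ℤ.* d                    ≤⟨ ℤP.i≤j+i _ (+ (n ℤD.% d)) ⟩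
  + (n ℤD.% d) ℤ.+ (n ℤ./ d) ℤ.* d   ≡⟨ ℤD.a≡a%n+[a/n]*n n d ⟨
  n                                  ≡⟨ ℤP.*-identityʳ n ⟨
  n ℤ.* 1ℤ                           ∎)
  where
  open ℤP.≤-Reasoning
  d = + suc d-1

<floor+1 : ∀ x → x < ι (ℤ.suc (floor x))
<floor+1 x@(mkℚ n d-1 _) rewrite ι≡mkℚ (ℤ.suc (floor x)) = *<* (begin-strict
  n ℤ.* 1ℤ                           ≡⟨ ℤP.*-identityʳ n ⟩
  n                                  ≡⟨ ℤD.a≡a%n+[a/n]*n n d ⟩
  + (n ℤD.% d) ℤ.+ (n ℤ./ d) ℤ.* d   <⟨ ℤP.+-monoˡ-< ((n ℤ./ d) ℤ.* d) (ℤ.+<+ (ℤD.n%d<d n d)) ⟩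
  d ℤ.+ (n ℤ./ d) ℤ.* d              ≡⟨ solve 2 (λ d q → d :+ q :* d := (con 1ℤ :+ q) :* d) refl d (n ℤ./ d) ⟩
  ℤ.suc (n ℤ./ d) ℤ.* d              ∎)
  where
  open ℤP.≤-Reasoning
  open +-*-Solver
  d = + suc d-1

<suc⇒≤ : ∀ {k m} → k ℤ.< ℤ.suc m → k ℤ.≤ m
<suc⇒≤ {k} {m} k<m+1 = subst (k ℤ.≤_) (ℤP.pred-suc m) (ℤP.i<j⇒i≤pred[j] k<m+1)

floor-unique : ∀ x k → ι k ≤ x → x < ι (ℤ.suc k) → floor x ≡ k
floor-unique x k ιk≤x x<ιk+1 = ℤP.≤-antisym
  (<suc⇒≤ (ι-cancel-< (ℚP.≤-<-trans (floor-≤ x) x<ιk+1)))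
  (<suc⇒≤ (ι-cancel-< (ℚP.≤-<-trans ιk≤x (<floor+1 x))))

floor-ι : ∀ k → floor (ι k) ≡ k
floor-ι k = floor-unique (ι k) k ℚP.≤-refl (ι-mono-< (ℤP.suc[i]≤j⇒i<j {k} ℤP.≤-refl))

neg-involutive : ∀ p → - - p ≡ p
neg-involutive = ℚS.solve 1 (λ p → ℚS.:- ℚS.:- p ℚS.:= p) refl

ceiling-via-floor : ∀ x → ceiling x ≡ ℤ.- floor (- x)
ceiling-via-floor record{} = refl

≤ceiling : ∀ x → x ≤ ι (ceiling x)
≤ceiling x@record{} = subst₂ _≤_ (neg-involutive x) (sym (ι-neg (floor (- x))))
  (ℚP.neg-antimono-≤ (floor-≤ (- x)))

ceiling-1< : ∀ x → ι (ℤ.pred (ceiling x)) < x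
ceiling-1< x@record{} = subst₂ _<_ ι-pred (neg-involutive x)
  (ℚP.neg-antimono-< (<floor+1 (- x)))
  where
  ι-pred : - ι (ℤ.suc (floor (- x))) ≡ ι (ℤ.pred (ceiling x))
  ι-pred = trans (sym (ι-neg (ℤ.suc (floor (- x))))) (cong ι (ℤP.neg-distrib-+ 1ℤ (floor (- x))))

ceiling-ι : ∀ k → ceiling (ι k) ≡ k
ceiling-ι k = begin
  ceiling (ι k)         ≡⟨ ceiling-via-floor (ι k) ⟩
  ℤ.- floor (- ι k)     ≡⟨ cong (λ q → ℤ.- floor q) (ι-neg k) ⟨
  ℤ.- floor (ι (ℤ.- k)) ≡⟨ cong ℤ.-_ (floor-ι (ℤ.- k)) ⟩
  ℤ.- ℤ.- k             ≡⟨ ℤP.neg-involutive k ⟩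
  k                     ∎
  where open ≡-Reasoning

ceiling-mono : ∀ {x y} → x ≤ y → ceiling x ℤ.≤ ceiling y
ceiling-mono {x} {y} x≤y = subst (ℤ._≤ ceiling y) (ℤP.suc-pred (ceiling x))
  (ℤP.i<j⇒suc[i]≤j (ι-cancel-< {ℤ.pred (ceiling x)}
    (ℚP.<-≤-trans (ceiling-1< x) (ℚP.≤-trans x≤y (≤ceiling y)))))

≤∧≢⇒< : ∀ {p q} → p ≤ q → p ≢ q → p < q
≤∧≢⇒< {p} {q} p≤q p≢q with ℚP.<-cmp p q
... | tri< p<q _ _ = p<q
... | tri≈ _ p≡q _ = ⊥-elim (p≢q p≡q)
... | tri> _ _ p>q = ⊥-elim (ℚP.<-irrefl refl (ℚP.<-≤-trans p>q p≤q))

frac-nonneg : ∀ x → 0ℚ ≤ frac x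
frac-nonneg x = subst (_≤ frac x) (ℚP.+-inverseʳ (ι (floor x))) (ℚP.+-monoˡ-≤ (- ι (floor x)) (floor-≤ x))

frac<1 : ∀ x → frac x < 1ℚ
frac<1 x = subst (frac x <_) (ℚS.solve 1 (λ f → (con 1ℚ :+ f) :- f := con 1ℚ) refl (ι (floor x)))
  (ℚP.+-monoˡ-< (- ι (floor x)) (subst (x <_) (ι-+ 1ℤ (floor x)) (<floor+1 x)))
  where open ℚS

frac-pos : ∀ x → frac x ≢ 0ℚ → 0ℚ < frac x
frac-pos x φ≢0 = ≤∧≢⇒< (frac-nonneg x) (λ 0≡φ → φ≢0 (sym 0≡φ))

frac-ι : ∀ k → frac (ι k) ≡ 0ℚ
frac-ι k rewrite floor-ι k = ℚP.+-inverseʳ (ι k)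

integral-is-floor : ∀ x → frac x ≡ 0ℚ → x ≡ ι (floor x)
integral-is-floor x φ≡0 = begin
  x                     ≡⟨ solve 2 (λ x f → x := (x :- f) :+ f) refl x (ι (floor x)) ⟩
  frac x + ι (floor x)  ≡⟨ cong (_+ ι (floor x)) φ≡0 ⟩
  0ℚ + ι (floor x)      ≡⟨ ℚP.+-identityˡ _ ⟩
  ι (floor x)           ∎
  where
  open ≡-Reasoning
  open ℚS

ceiling-integral : ∀ x → frac x ≡ 0ℚ → ceiling x ≡ floor x
ceiling-integral x φ≡0 = trans (cong ceiling (integral-is-floor x φ≡0)) (ceiling-ι (floor x))

integral-is-ceiling : ∀ x → frac x ≡ 0ℚ → x ≡ ι (ceiling x)
integral-is-ceiling x φ≡0 = trans (integral-is-floor x φ≡0) (cong ι (sym (ceiling-integral x φ≡0)))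

fractional<ceiling : ∀ x → frac x ≢ 0ℚ → x < ι (ceiling x)
fractional<ceiling x φ≢0 = ≤∧≢⇒< (≤ceiling x)
  (λ x≡c → φ≢0 (subst (λ q → frac q ≡ 0ℚ) (sym x≡c) (frac-ι (ceiling x))))

floor-fractional : ∀ x → frac x ≢ 0ℚ → floor x ≡ ℤ.pred (ceiling x)
floor-fractional x φ≢0 = floor-unique x (ℤ.pred (ceiling x)) (ℚP.<⇒≤ (ceiling-1< x))
  (subst (λ c → x < ι c) (sym (ℤP.suc-pred (ceiling x))) (fractional<ceiling x φ≢0))

frac-mono : ∀ {x y} → x < y → frac x ≢ 0ℚ → frac y ≢ 0ℚ → ceiling x ≡ ceiling y → frac x < frac y
frac-mono {x} {y} x<y φx≢0 φy≢0 ⌈x⌉≡⌈y⌉ =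
  subst (λ k → frac x < y - ι k) floor-x≡floor-y (ℚP.+-monoˡ-< (- ι (floor x)) x<y)
  where
  floor-x≡floor-y : floor x ≡ floor y
  floor-x≡floor-y = trans (floor-fractional x φx≢0)
    (trans (cong ℤ.pred ⌈x⌉≡⌈y⌉) (sym (floor-fractional y φy≢0)))

inv-antimono-< : ∀ {p q} → 0ℚ < p → p < q → inv q < inv p
inv-antimono-< {mkℚ +[1+ n ] d _} {mkℚ +[1+ m ] e _} _ (*<* h) =
  *<* (subst₂ ℤ._<_ (ℤP.*-comm +[1+ n ] +[1+ e ]) (ℤP.*-comm +[1+ m ] +[1+ d ]) h)
inv-antimono-< {mkℚ +[1+ n ] d _} {mkℚ (+ 0) e _} _ (*<* (ℤ.+<+ ()))
inv-antimono-< {mkℚ +[1+ n ] d _} {mkℚ -[1+ m ] e _} _ (*<* ())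
inv-antimono-< {mkℚ (+ 0) d _} (*<* (ℤ.+<+ ()))
inv-antimono-< {mkℚ -[1+ n ] d _} (*<* ())

inv-antimono-≤ : ∀ {p q} → 0ℚ < p → p ≤ q → inv q ≤ inv p
inv-antimono-≤ {mkℚ +[1+ n ] d _} {mkℚ +[1+ m ] e _} _ (*≤* h) =
  *≤* (subst₂ ℤ._≤_ (ℤP.*-comm +[1+ n ] +[1+ e ]) (ℤP.*-comm +[1+ m ] +[1+ d ]) h)
inv-antimono-≤ {mkℚ +[1+ n ] d _} {mkℚ (+ 0) e _} _ (*≤* (ℤ.+≤+ ()))
inv-antimono-≤ {mkℚ +[1+ n ] d _} {mkℚ -[1+ m ] e _} _ (*≤* ())
inv-antimono-≤ {mkℚ (+ 0) d _} (*<* (ℤ.+<+ ()))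
inv-antimono-≤ {mkℚ -[1+ n ] d _} (*<* ())

-- For 0 < p < 1 the inverse 1/p has the smaller denominator ↥ p.
↧-inv : ∀ {p} → 0ℚ < p → p < 1ℚ → ↧ₙ (inv p) ℕ.< ↧ₙ p
↧-inv {mkℚ +[1+ n ] d _} _ (*<* h)
  with ℤ.+<+ n<d ← subst₂ ℤ._<_ (ℤP.*-identityʳ +[1+ n ]) (ℤP.*-identityˡ (+ suc d)) h = n<d
↧-inv {mkℚ (+ 0) d _} (*<* (ℤ.+<+ ()))
↧-inv {mkℚ -[1+ n ] d _} (*<* ())

↧-/ : ∀ i n .{{_ : ℕ.NonZero n}} → ↧ₙ (i / n) ℕ.≤ n
↧-/ i n = ∣⇒≤ (subst (↧ₙ (i / n) ∣_) ↧*gcd≡n (m∣m*n _))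
  where
  ↧*gcd≡n : ↧ₙ (i / n) ℕ.* gcd ℤ.∣ i ∣ n ≡ n
  ↧*gcd≡n = ℤP.+-injective (trans (ℤP.pos-* (↧ₙ (i / n)) _) (ℚP.↧-/ i n))

↧-+ : ∀ p q → ↧ₙ (p + q) ℕ.≤ ↧ₙ p ℕ.* ↧ₙ q
↧-+ p@record{} q@record{} = ↧-/ (↥ p ℤ.* ↧ q ℤ.+ ↥ q ℤ.* ↧ p) (↧ₙ p ℕ.* ↧ₙ q)

↧-+-integer : ∀ p q → ↧ₙ q ≡ 1 → ↧ₙ (p + q) ℕ.≤ ↧ₙ p
↧-+-integer p q ↧q≡1 = subst (↧ₙ (p + q) ℕ.≤_)
  (trans (cong (↧ₙ p ℕ.*_) ↧q≡1) (ℕP.*-identityʳ (↧ₙ p))) (↧-+ p q)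

↧-frac : ∀ x → ↧ₙ (frac x) ℕ.≤ ↧ₙ x
↧-frac x = ↧-+-integer x (- ι (floor x))
  (ℤP.+-injective (trans (ℚP.↧-neg (ι (floor x))) (↧ι (floor x))))

↧-1- : ∀ φ → ↧ₙ (1ℚ - φ) ℕ.≤ ↧ₙ φ
↧-1- φ = subst₂ ℕ._≤_ (cong ↧ₙ_ (ℚP.+-comm (- φ) 1ℚ)) (ℤP.+-injective (ℚP.↧-neg φ))
  (↧-+-integer (- φ) 1ℚ refl)

0<- : ∀ {a b} → a < b → 0ℚ < b - a
0<- {a} {b} a<b = subst (_< b - a) (ℚP.+-inverseʳ a) (ℚP.+-monoˡ-< (- a) a<b)

0≤- : ∀ {a b} → a ≤ b → 0ℚ ≤ b - a
0≤- {a} {b} a≤b = subst (_≤ b - a) (ℚP.+-inverseʳ a) (ℚP.+-monoˡ-≤ (- a) a≤b)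

-‿antimono-< : ∀ c {a b} → a < b → c - b < c - a
-‿antimono-< c a<b = ℚP.+-monoʳ-< c (ℚP.neg-antimono-< a<b)

-‿antimono-≤ : ∀ c {a b} → a ≤ b → c - b ≤ c - a
-‿antimono-≤ c a≤b = ℚP.+-monoʳ-≤ c (ℚP.neg-antimono-≤ a≤b)

-- They are opaque: the `inv` inside them is itself a case split on `frac x ≟ 0ℚ`,
-- and must not be disturbed when the definition of s is unfolded by that split.
opaque
  lowRest highRest : ℚ → ℚ
  lowRest  x = inv (frac x) - 2ℚ
  highRest x = inv (1ℚ - frac x) - 2ℚ

  lowRest-def : ∀ x → inv (frac x) - 2ℚ ≡ lowRest x
  lowRest-def x = refl

  highRest-def : ∀ x → inv (1ℚ - frac x) - 2ℚ ≡ highRest x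
  highRest-def x = refl

  -- Both continuations have a strictly smaller denominator than x: this is why
  -- the recursion terminates and why induction on denominators is possible.
  ↧-lowRest : ∀ x → frac x ≢ 0ℚ → ↧ₙ (lowRest x) ℕ.< ↧ₙ x
  ↧-lowRest x φ≢0 = ℕP.≤-<-trans (↧-+-integer (inv (frac x)) (- 2ℚ) refl)
    (ℕP.<-≤-trans (↧-inv (frac-pos x φ≢0) (frac<1 x)) (↧-frac x))

  ↧-highRest : ∀ x → frac x ≢ 0ℚ → ↧ₙ (highRest x) ℕ.< ↧ₙ x
  ↧-highRest x φ≢0 = ℕP.≤-<-trans (↧-+-integer (inv (1ℚ - frac x)) (- 2ℚ) refl)
    (ℕP.<-≤-trans (↧-inv (0<- (frac<1 x)) (-‿antimono-< 1ℚ (frac-pos x φ≢0)))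
      (ℕP.≤-trans (↧-1- (frac x)) (↧-frac x)))

  lowRest-pos : ∀ x → frac x ≢ 0ℚ → frac x < ½ → 0ℚ < lowRest x
  lowRest-pos x φ≢0 φ<½ = 0<- (inv-antimono-< (frac-pos x φ≢0) φ<½)

  highRest-nonneg : ∀ x → ½ ≤ frac x → 0ℚ ≤ highRest x
  highRest-nonneg x ½≤φ = 0≤- (inv-antimono-≤ (0<- (frac<1 x)) (-‿antimono-≤ 1ℚ ½≤φ))

  lowRest-antimono : ∀ x y → frac x ≢ 0ℚ → frac x < frac y → lowRest y < lowRest x
  lowRest-antimono x y φx≢0 φx<φy =
    ℚP.+-monoˡ-< (- 2ℚ) (inv-antimono-< (frac-pos x φx≢0) φx<φy)

  highRest-mono : ∀ x y → frac x < frac y → highRest x < highRest y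
  highRest-mono x y φx<φy =
    ℚP.+-monoˡ-< (- 2ℚ) (inv-antimono-< (0<- (frac<1 y)) (-‿antimono-< 1ℚ φx<φy))

data Kind (x : ℚ) : Set where
  integral : frac x ≡ 0ℚ → Kind x
  low      : frac x ≢ 0ℚ → frac x < ½ → Kind x
  high     : frac x ≢ 0ℚ → ½ ≤ frac x → Kind x

kind : ∀ x → Kind x
kind x with frac x ℚP.≟ 0ℚ
... | yes φ≡0 = integral φ≡0
... | no φ≢0 with frac x ℚP.<? ½
...   | yes φ<½ = low φ≢0 φ<½
...   | no φ≮½  = high φ≢0 (ℚP.≮⇒≥ φ≮½)

sFuel-integral : ∀ n x → frac x ≡ 0ℚ → sFuel (suc n) x ≡ [ floor x ]
sFuel-integral n x φ≡0 with frac x ℚP.≟ 0ℚ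
... | yes _  = refl
... | no φ≢0 = ⊥-elim (φ≢0 φ≡0)

sFuel-low : ∀ n x → frac x ≢ 0ℚ → frac x < ½ →
            sFuel (suc n) x ≡ ceiling x ∷ negate (sFuel n (lowRest x))
sFuel-low n x φ≢0 φ<½ with frac x ℚP.≟ 0ℚ
... | yes φ≡0 = ⊥-elim (φ≢0 φ≡0)
... | no _ with frac x ℚP.<? ½
...   | yes _  = cong (λ r → ceiling x ∷ negate (sFuel n r)) (lowRest-def x)
...   | no φ≮½ = ⊥-elim (φ≮½ φ<½)

sFuel-high : ∀ n x → frac x ≢ 0ℚ → ½ ≤ frac x →
             sFuel (suc n) x ≡ ceiling x ∷ sFuel n (highRest x)
sFuel-high n x φ≢0 ½≤φ with frac x ℚP.≟ 0ℚ
... | yes φ≡0 = ⊥-elim (φ≢0 φ≡0)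
... | no _ with frac x ℚP.<? ½
...   | yes φ<½ = ⊥-elim (ℚP.<-irrefl refl (ℚP.<-≤-trans φ<½ ½≤φ))
...   | no _    = cong (λ r → ceiling x ∷ sFuel n r) (highRest-def x)

sFuel-stable : ∀ n m x → ↧ₙ x ℕ.< n → ↧ₙ x ℕ.< m → sFuel n x ≡ sFuel m x
sFuel-stable (suc n) (suc m) x (ℕ.s≤s ↧x≤n) (ℕ.s≤s ↧x≤m) = by-kind (kind x)
  where
  open ≡-Reasoning
  rests : ∀ z → ↧ₙ z ℕ.< ↧ₙ x → sFuel n z ≡ sFuel m z
  rests z ↧z<↧x = sFuel-stable n m z (ℕP.<-≤-trans ↧z<↧x ↧x≤n) (ℕP.<-≤-trans ↧z<↧x ↧x≤m)
  by-kind : Kind x → sFuel (suc n) x ≡ sFuel (suc m) x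
  by-kind (integral φ≡0) = trans (sFuel-integral n x φ≡0) (sym (sFuel-integral m x φ≡0))
  by-kind (low φ≢0 φ<½) = begin
    sFuel (suc n) x                           ≡⟨ sFuel-low n x φ≢0 φ<½ ⟩
    ceiling x ∷ negate (sFuel n (lowRest x))  ≡⟨ cong (λ t → ceiling x ∷ negate t)
                                                   (rests (lowRest x) (↧-lowRest x φ≢0)) ⟩
    ceiling x ∷ negate (sFuel m (lowRest x))  ≡⟨ sFuel-low m x φ≢0 φ<½ ⟨
    sFuel (suc m) x                           ∎
  by-kind (high φ≢0 ½≤φ) = begin
    sFuel (suc n) x                   ≡⟨ sFuel-high n x φ≢0 ½≤φ ⟩
    ceiling x ∷ sFuel n (highRest x)  ≡⟨ cong (ceiling x ∷_) (rests (highRest x) (↧-highRest x φ≢0)) ⟩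
    ceiling x ∷ sFuel m (highRest x)  ≡⟨ sFuel-high m x φ≢0 ½≤φ ⟨
    sFuel (suc m) x                   ∎

s-integral : ∀ x → frac x ≡ 0ℚ → s x ≡ [ ceiling x ]
s-integral x φ≡0 = trans (sFuel-integral (↧ₙ x) x φ≡0) (cong [_] (sym (ceiling-integral x φ≡0)))

s-low : ∀ x → frac x ≢ 0ℚ → frac x < ½ → s x ≡ ceiling x ∷ negate (s (lowRest x))
s-low x φ≢0 φ<½ = trans (sFuel-low (↧ₙ x) x φ≢0 φ<½) (cong (λ t → ceiling x ∷ negate t)
  (sFuel-stable (↧ₙ x) _ (lowRest x) (↧-lowRest x φ≢0) (ℕP.n<1+n _)))

s-high : ∀ x → frac x ≢ 0ℚ → ½ ≤ frac x → s x ≡ ceiling x ∷ s (highRest x)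
s-high x φ≢0 ½≤φ = trans (sFuel-high (↧ₙ x) x φ≢0 ½≤φ) (cong (ceiling x ∷_)
  (sFuel-stable (↧ₙ x) _ (highRest x) (↧-highRest x φ≢0) (ℕP.n<1+n _)))

s-head : ∀ x → Σ (List ℤ) λ t → s x ≡ ceiling x ∷ t
s-head x with kind x
... | integral φ≡0 = [] , s-integral x φ≡0
... | low φ≢0 φ<½  = _ , s-low x φ≢0 φ<½
... | high φ≢0 ½≤φ = _ , s-high x φ≢0 ½≤φ

s-long : ∀ x → frac x ≢ 0ℚ → Σ ℤ λ h → Σ (List ℤ) λ t → s x ≡ ceiling x ∷ h ∷ t
s-long x φ≢0 with kind x
... | integral φ≡0 = ⊥-elim (φ≢0 φ≡0)
... | low _ φ<½ with s-head (lowRest x)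
...   | t , eq = _ , _ , trans (s-low x φ≢0 φ<½) (cong (λ u → ceiling x ∷ negate u) eq)
s-long x φ≢0 | high _ ½≤φ with s-head (highRest x)
...   | t , eq = _ , _ , trans (s-high x φ≢0 ½≤φ) (cong (ceiling x ∷_) eq)

-- After a nonempty prefix, a sequence that stops is above its extensions only
-- if its last entry is positive; hence comparisons after a nonempty prefix are
-- only claimed for a positive larger number.
Admissible : Prefix → ℚ → Set
Admissible none      y = ⊤
Admissible (after _) y = 0ℚ < y

admissible : ∀ π {y} → 0ℚ < y → Admissible π y
admissible none      _   = tt
admissible (after _) 0<y = 0<y

MonotoneBelow : ℚ → ℚ → Set
MonotoneBelow x y = ∀ π z z′ → ↧ₙ z ℕ.+ ↧ₙ z′ ℕ.< ↧ₙ x ℕ.+ ↧ₙ y →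
                    z < z′ → Admissible π z′ → Above π (s z′) (s z)

distinct-heads : ∀ π x y → ceiling x ℤ.< ceiling y → Above π (s y) (s x)
distinct-heads π x y ⌈x⌉<⌈y⌉ with s-head x | s-head y
... | _ , sx≡ | _ , sy≡ rewrite sx≡ | sy≡ = inj₁ ⌈x⌉<⌈y⌉

-- An integer y = ⌈x⌉ > x: s y = (c) is a proper prefix of s x = (c, h, ...).
integral-above : ∀ π x y → Admissible π y → frac x ≢ 0ℚ → frac y ≡ 0ℚ →
                 ceiling x ≡ ceiling y → Above π (s y) (s x)
integral-above π x y ok φx≢0 φy≡0 ⌈x⌉≡⌈y⌉ with s-long x φx≢0
... | _ , _ , sx≡ = subst₂ (Above π) (sym (s-integral y φy≡0)) (sym sx≡)
                      (inj₂ (sym ⌈x⌉≡⌈y⌉ , shorter π ok))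
  where
  shorter : ∀ π {h t} → Admissible π y → Above (extend π (ceiling y)) [] (h ∷ t)
  shorter none      _   = tt
  shorter (after _) 0<y = ι-cancel-< {0ℤ} (subst (0ℚ <_) (integral-is-ceiling y φy≡0) 0<y)

integral-not-below : ∀ x y → frac x ≡ 0ℚ → frac y ≢ 0ℚ → ceiling x ≡ ceiling y → y < x
integral-not-below x y φx≡0 φy≢0 ⌈x⌉≡⌈y⌉ =
  subst (y <_) (trans (cong ι (sym ⌈x⌉≡⌈y⌉)) (sym (integral-is-ceiling x φx≡0)))
    (fractional<ceiling y φy≢0)

integral-unique : ∀ x y → frac x ≡ 0ℚ → frac y ≡ 0ℚ → ceiling x ≡ ceiling y → x ≡ y
integral-unique x y φx≡0 φy≡0 ⌈x⌉≡⌈y⌉ =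
  trans (integral-is-ceiling x φx≡0) (trans (cong ι ⌈x⌉≡⌈y⌉) (sym (integral-is-ceiling y φy≡0)))

-- Both fractional parts at least ½: both sequences continue with highRest,
-- which is increasing, so the tails compare as the induction hypothesis says.
high-high : ∀ π x y → MonotoneBelow x y → frac x ≢ 0ℚ → frac y ≢ 0ℚ → ½ ≤ frac x → ½ ≤ frac y →
            frac x < frac y → ceiling x ≡ ceiling y → Above π (s y) (s x)
high-high π x y rec φx≢0 φy≢0 ½≤φx ½≤φy φx<φy ⌈x⌉≡⌈y⌉
  rewrite s-high x φx≢0 ½≤φx | s-high y φy≢0 ½≤φy | ⌈x⌉≡⌈y⌉ =
  inj₂ (refl , rec π′ (highRest x) (highRest y)
                 (ℕP.+-mono-< (↧-highRest x φx≢0) (↧-highRest y φy≢0))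
                 hx<hy (admissible π′ (ℚP.≤-<-trans (highRest-nonneg x ½≤φx) hx<hy)))
  where
  π′ = extend π (ceiling y)
  hx<hy = highRest-mono x y φx<φy

-- Natural representations are nonempty, so after a nonempty prefix negation
-- reverses their order.
negate-s : ∀ m m′ z z′ → Above (after m) (s z) (s z′) →
           Above (after m′) (negate (s z′)) (negate (s z))
negate-s m m′ z z′ g with s-head z | s-head z′
... | _ , sz≡ | _ , sz′≡ rewrite sz≡ | sz′≡ = Above-negate-cons m m′ g

-- Both fractional parts below ½: both sequences continue with the negated
-- lowRest, which is decreasing, so the order is reversed twice.
low-low : ∀ π x y → MonotoneBelow x y → frac x ≢ 0ℚ → frac y ≢ 0ℚ → frac x < ½ → frac y < ½ →
          frac x < frac y → ceiling x ≡ ceiling y → Above π (s y) (s x)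
low-low π x y rec φx≢0 φy≢0 φx<½ φy<½ φx<φy ⌈x⌉≡⌈y⌉
  rewrite s-low x φx≢0 φx<½ | s-low y φy≢0 φy<½ | ⌈x⌉≡⌈y⌉ =
  inj₂ (refl , negate-s nothing _ (lowRest x) (lowRest y) tails)
  where
  tails : Above (after nothing) (s (lowRest x)) (s (lowRest y))
  tails = rec (after nothing) (lowRest y) (lowRest x)
            (subst (ℕ._< ↧ₙ x ℕ.+ ↧ₙ y) (ℕP.+-comm (↧ₙ (lowRest x)) (↧ₙ (lowRest y)))
              (ℕP.+-mono-< (↧-lowRest x φx≢0) (↧-lowRest y φy≢0)))
            (lowRest-antimono x y φx≢0 φx<φy) (lowRest-pos x φx≢0 φx<½)

-- φ_x < ½ ≤ φ_y: after the common head, s y continues with ⌈highRest y⌉ ≥ 0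
-- while s x continues with -⌈lowRest x⌉ < 0.
low-high : ∀ π x y → frac x ≢ 0ℚ → frac y ≢ 0ℚ → frac x < ½ → ½ ≤ frac y →
           ceiling x ≡ ceiling y → Above π (s y) (s x)
low-high π x y φx≢0 φy≢0 φx<½ ½≤φy ⌈x⌉≡⌈y⌉
  rewrite s-low x φx≢0 φx<½ | s-high y φy≢0 ½≤φy | ⌈x⌉≡⌈y⌉
  with s-head (lowRest x) | s-head (highRest y)
... | _ , sl≡ | _ , sh≡ rewrite sl≡ | sh≡ = inj₂ (refl , inj₁ (ℤP.<-≤-trans -⌈l⌉<0 0≤⌈h⌉))
  where
  -⌈l⌉<0 : ℤ.- ceiling (lowRest x) ℤ.< 0ℤ
  -⌈l⌉<0 = ℤP.neg-mono-< (ι-cancel-< {0ℤ}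
    (ℚP.<-≤-trans (lowRest-pos x φx≢0 φx<½) (≤ceiling (lowRest x))))
  0≤⌈h⌉ : 0ℤ ℤ.≤ ceiling (highRest y)
  0≤⌈h⌉ = ι-cancel-≤ {0ℤ} (ℚP.≤-trans (highRest-nonneg y ½≤φy) (≤ceiling (highRest y)))

same-ceiling : ∀ π x y → x < y → Admissible π y → MonotoneBelow x y → ceiling x ≡ ceiling y →
               Kind x → Kind y → Above π (s y) (s x)
same-ceiling π x y x<y ok rec c≡ (integral φx≡0) (integral φy≡0) =
  ⊥-elim (ℚP.<-irrefl (integral-unique x y φx≡0 φy≡0 c≡) x<y)
same-ceiling π x y x<y ok rec c≡ (integral φx≡0) (low φy≢0 _) =
  ⊥-elim (ℚP.<-asym x<y (integral-not-below x y φx≡0 φy≢0 c≡))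
same-ceiling π x y x<y ok rec c≡ (integral φx≡0) (high φy≢0 _) =
  ⊥-elim (ℚP.<-asym x<y (integral-not-below x y φx≡0 φy≢0 c≡))
same-ceiling π x y x<y ok rec c≡ (low φx≢0 _) (integral φy≡0) = integral-above π x y ok φx≢0 φy≡0 c≡
same-ceiling π x y x<y ok rec c≡ (high φx≢0 _) (integral φy≡0) = integral-above π x y ok φx≢0 φy≡0 c≡
same-ceiling π x y x<y ok rec c≡ (low φx≢0 φx<½) (low φy≢0 φy<½) =
  low-low π x y rec φx≢0 φy≢0 φx<½ φy<½ (frac-mono x<y φx≢0 φy≢0 c≡) c≡
same-ceiling π x y x<y ok rec c≡ (low φx≢0 φx<½) (high φy≢0 ½≤φy) =
  low-high π x y φx≢0 φy≢0 φx<½ ½≤φy c≡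
same-ceiling π x y x<y ok rec c≡ (high φx≢0 ½≤φx) (low φy≢0 φy<½) =
  ⊥-elim (ℚP.<-irrefl refl (ℚP.<-trans (ℚP.≤-<-trans ½≤φx (frac-mono x<y φx≢0 φy≢0 c≡)) φy<½))
same-ceiling π x y x<y ok rec c≡ (high φx≢0 ½≤φx) (high φy≢0 ½≤φy) =
  high-high π x y rec φx≢0 φy≢0 ½≤φx ½≤φy (frac-mono x<y φx≢0 φy≢0 c≡) c≡

monotone-step : ∀ π x y → x < y → Admissible π y → MonotoneBelow x y → Above π (s y) (s x)
monotone-step π x y x<y ok rec with ℤP.<-cmp (ceiling x) (ceiling y)
... | tri< ⌈x⌉<⌈y⌉ _ _ = distinct-heads π x y ⌈x⌉<⌈y⌉
... | tri≈ _ ⌈x⌉≡⌈y⌉ _ = same-ceiling π x y x<y ok rec ⌈x⌉≡⌈y⌉ (kind x) (kind y)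
... | tri> _ _ ⌈x⌉>⌈y⌉ = ⊥-elim (ℤP.<⇒≱ ⌈x⌉>⌈y⌉ (ceiling-mono (ℚP.<⇒≤ x<y)))

s-monotone : ∀ π x y → x < y → Admissible π y → Above π (s y) (s x)
s-monotone π x y = <-rec Monotone step (↧ₙ x ℕ.+ ↧ₙ y) π x y refl
  where
  Monotone : ℕ → Set
  Monotone n = ∀ π x y → ↧ₙ x ℕ.+ ↧ₙ y ≡ n → x < y → Admissible π y → Above π (s y) (s x)
  step : ∀ n → (∀ {m} → m ℕ.< n → Monotone m) → Monotone n
  step n ih π x y refl x<y ok = monotone-step π x y x<y ok (λ π z z′ size< → ih size< π z z′ refl)

s-strictly-monotone : ∀ {x y} → x < y → s y ≻ s x
s-strictly-monotone {x} {y} x<y = Above⇒≻ (s y) (s x) empty (s-monotone none x y x<y tt)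

mainTheorem3 : ∀ (x y : ℚ) → (x ≤ y → s x ⪯ s y) × (s x ⪯ s y → x ≤ y)
mainTheorem3 x y = preserves , reflects
  where
  preserves : x ≤ y → s x ⪯ s y
  preserves x≤y with ℚP.<-cmp x y
  ... | tri< x<y _ _ = inj₂ (s-strictly-monotone x<y)
  ... | tri≈ _ x≡y _ = inj₁ (cong s x≡y)
  ... | tri> _ _ y<x = ⊥-elim (ℚP.<-irrefl refl (ℚP.<-≤-trans y<x x≤y))
  reflects : s x ⪯ s y → x ≤ y
  reflects sx⪯sy = ℚP.≮⇒≥ (λ y<x → ⪯⇒⊁ sx⪯sy (s-strictly-monotone y<x))
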